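{- For all integers $s \ge 1$ and $t \ge 3$: (i) $|EN_{s,1}(123)| = 1$; (ii) $|EN_{s,2}(123)| = C_s$; (iii) $|EN_{s,t}(123)| = 0$. Here $C_n=\frac{1}{n+1}\binom{2n}{n}$ is the $n$th Catalan number.
   Context: For positive integers $s,t$, write each $x \in [st]=\{1,\dots,st\}$ uniquely as $x=(j-1)t+r$ with $1\le j\le s$ and $1\le r\le t$. The poset $EN_{s,t}$ is $[st]$ with the partial order $(j-1)t+r \preceq (j'-1)t+r'$ if and only if $j'\le j$ and $r\le r'$. A linear extension of a poset $([n],\preceq)$ is a permutation $\pi=\pi(1)\cdots\pi(n)$ of $[n]$ (one-line notation) such that whenever $a\preceq b$ and $a\ne b$, $a$ appears before $b$ in $\pi$. A permutation $\pi$ contains $\sigma$ if $\pi$ has a subsequence with the same relative order as $\sigma$, and avoids $\sigma$ otherwise. $P(\sigma_1,\dots,\sigma_k)$ denotes the set of linear extensions of the poset $P$ avoiding each $\sigma_i$. -}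

module Defs where

open import Data.Nat using (ℕ; zero; suc; _+_; _*_; _≤_; _<_; _/_)
open import Data.Nat.Combinatorics using (_C_)
open import Data.List using (List; []; _∷_; _++_; map; upTo; length)
open import Data.List.Membership.Propositional using (_∈_)
open import Data.List.Relation.Unary.Unique.Propositional using (Unique)
open import Data.List.Relation.Binary.Permutation.Propositional using (_↭_)
open import Data.Product using (Σ; _×_; ∃; ∃-syntax; _,_)
open import Relation.Binary.PropositionalEquality using (_≡_; _≢_)
open import Relation.Nullary using (¬_)
open import Function.Bundles using (_⇔_)

range : ℕ → List ℕ
range n = map suc (upTo n)

-- The order of EN_{s,t} on [st]:  x = (j-1)t + r  with  j0 = j-1 < s,  1 ≤ r ≤ t.
-- (j-1)t + r ⪯ (j'-1)t + r'  iff  j' ≤ j  and  r ≤ r'.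
ENle : ℕ → ℕ → ℕ → ℕ → Set
ENle s t x y =
  ∃[ j0 ] ∃[ r ] ∃[ j0' ] ∃[ r' ]
    (j0 < s × 1 ≤ r × r ≤ t × x ≡ j0 * t + r ×
     j0' < s × 1 ≤ r' × r' ≤ t × y ≡ j0' * t + r' ×
     j0' ≤ j0 × r ≤ r')

Before : ℕ → ℕ → List ℕ → Set
Before a b π = ∃[ xs ] ∃[ ys ] (π ≡ xs ++ (a ∷ ys) × b ∈ ys)

IsLinExt : ℕ → ℕ → List ℕ → Set
IsLinExt s t π =
  (π ↭ range (s * t)) ×
  (∀ a b → ENle s t a b → a ≢ b → Before a b π)

Contains123 : List ℕ → Set
Contains123 π =
  ∃[ a ] ∃[ b ] ∃[ c ] ∃[ xs ] ∃[ ys ] ∃[ zs ] ∃[ ws ]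
    (a < b × b < c × π ≡ xs ++ (a ∷ ys ++ (b ∷ zs ++ (c ∷ ws))))

Avoids123 : List ℕ → Set
Avoids123 π = ¬ Contains123 π

EN123 : ℕ → ℕ → List ℕ → Set
EN123 s t π = IsLinExt s t π × Avoids123 π

HasCard : (List ℕ → Set) → ℕ → Set
HasCard P k = ∃[ L ] (Unique L × (∀ π → (π ∈ L) ⇔ P π) × length L ≡ k)

catalan : ℕ → ℕ
catalan n = ((2 * n) C n) / suc n

module Submission where

-- Write x = j0 * t + r with 1 ≤ r ≤ t. The elements of one column r form a chain of EN_{s,t},
-- and every linear extension lists them in decreasing order. Hence for t ≤ 2, where any three
-- elements contain two of the same column, no linear extension contains 123, and EN_{s,t}(123)
-- is the set of all linear extensions. For t = 1 the poset is the chain s ≺ ⋯ ≺ 1. For t = 2 a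
-- linear extension is built from the front by placing either the largest remaining odd number,
-- or the largest remaining even number once the odd number just below it has been placed. With
-- a odd and b ≥ a even numbers left this yields the ballot number C(a+b,b) − C(a+b,b+1) of
-- extensions, which for a = b = s is the Catalan number. For t ≥ 3 the chain 1 ≺ 2 ≺ 3 of the
-- first row is a 123 pattern in every linear extension.

open import Defs
open import Data.Nat
open import Data.Nat.Properties
open import Data.Nat.Combinatorics
  using (_C_; nCk+nC[k+1]≡[n+1]C[k+1]; k>n⇒nCk≡0; nCn≡1; nC1≡n; nCk≡nC[n∸k])
open import Data.Nat.DivMod using (m≡m%n+[m/n]*n; m%n<n; m<n*o⇒m/o<n; m*n/n≡m)
open import Data.Nat.Tactic.RingSolver using (solve-∀)
open import Data.List using (List; []; _∷_; _++_; [_]; map; length)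
open import Data.List.Properties using (++-assoc; ∷-injective; ∷-injectiveʳ; length-map; length-++)
open import Data.List.Membership.Propositional using (_∈_; _∉_)
open import Data.List.Membership.Propositional.Properties
  using (∈-++⁺ˡ; ∈-++⁺ʳ; ∈-++⁻; ∈-∃++; ∈-map⁺; ∈-map⁻; map∷⁻; ∈-upTo⁺; ∈-upTo⁻)
open import Data.List.Membership.Propositional.Properties.WithK using (unique∧set⇒bag)
open import Data.List.Relation.Binary.BagAndSetEquality using (∼bag⇒↭)
open import Data.List.Relation.Binary.Permutation.Propositional using (_↭_; ↭-sym; ↭⇒↭ₛ)
open import Data.List.Relation.Binary.Permutation.Propositional.Properties using (∈-resp-↭)
import Data.List.Relation.Binary.Permutation.Setoid.Properties as Permutationₛ
open import Data.List.Relation.Unary.Any using (here; there; tail)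
import Data.List.Relation.Unary.All as All
open import Data.List.Relation.Unary.All.Properties using (All¬⇒¬Any)
open import Data.List.Relation.Unary.AllPairs using ([]; _∷_)
open import Data.List.Relation.Unary.Unique.Propositional using (Unique)
open import Data.List.Relation.Unary.Unique.Propositional.Properties using (map⁺; upTo⁺; ++⁺)
open import Data.Product using (∃-syntax; _×_; _,_; proj₁; proj₂)
open import Data.Sum using (_⊎_; inj₁; inj₂)
open import Data.Empty using (⊥-elim)
open import Function.Base using (case_of_)
open import Function.Bundles using (_⇔_; mk⇔; Equivalence)
open import Function.Construct.Composition using (_⇔-∘_)
open import Function.Construct.Symmetry using (⇔-sym)
open import Relation.Binary.Definitions using (tri<; tri≈; tri>)
open import Relation.Binary.PropositionalEquality
  using (_≡_; _≢_; refl; sym; trans; cong; cong₂; subst; ≢-sym; setoid; module ≡-Reasoning)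
open import Relation.Nullary using (¬_; yes; no)

open Equivalence using (to; from)

private
  variable
    a b c i k s t x y z : ℕ
    xs ys π : List ℕ
    P Q : ℕ → Set
    R R′ : ℕ → ℕ → Set

Before-∷⁺ : Before x y π → Before x y (z ∷ π)
Before-∷⁺ (xs , ys , refl , y∈ys) = _ ∷ xs , ys , refl , y∈ys

Before-∷⁻ : Before x y (z ∷ π) → (x ≡ z × y ∈ π) ⊎ Before x y π
Before-∷⁻ ([] , ys , refl , y∈ys) = inj₁ (refl , y∈ys)
Before-∷⁻ (_ ∷ xs , ys , refl , y∈ys) = inj₂ (xs , ys , refl , y∈ys)

Before⇒∈ˡ : Before x y π → x ∈ π
Before⇒∈ˡ (xs , ys , refl , _) = ∈-++⁺ʳ xs (here refl)

Before⇒∈ʳ : Before x y π → y ∈ π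
Before⇒∈ʳ (xs , ys , refl , y∈ys) = ∈-++⁺ʳ xs (there y∈ys)

Unique-head : Unique (x ∷ xs) → x ∉ xs
Unique-head (x∉xs ∷ _) = All¬⇒¬Any x∉xs

Unique-drop : ∀ xs → Unique (xs ++ ys) → Unique ys
Unique-drop [] u = u
Unique-drop (_ ∷ xs) (_ ∷ u) = Unique-drop xs u

Unique-split : ∀ xs {xs′ ys ys′} → Unique (xs ++ x ∷ ys) →
               xs ++ x ∷ ys ≡ xs′ ++ x ∷ ys′ → ys ≡ ys′
Unique-split [] {[]} u refl = refl
Unique-split [] {_ ∷ xs′} u refl = ⊥-elim (Unique-head u (∈-++⁺ʳ xs′ (here refl)))
Unique-split (_ ∷ xs) {[]} u refl = ⊥-elim (Unique-head u (∈-++⁺ʳ xs (here refl)))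
Unique-split (_ ∷ xs) {_ ∷ xs′} (_ ∷ u) eq with refl , eq′ ← ∷-injective eq = Unique-split xs u eq′

Before-after : ∀ xs → Unique (xs ++ x ∷ ys) → Before x y (xs ++ x ∷ ys) → y ∈ ys
Before-after xs u (_ , _ , eq , y∈ys′) = subst (_ ∈_) (sym (Unique-split xs u eq)) y∈ys′

Before-after-∷ : ∀ xs {ys₁ ys₂} → Unique (xs ++ a ∷ ys₁ ++ b ∷ ys₂) →
                 Before b c (xs ++ a ∷ ys₁ ++ b ∷ ys₂) → c ∈ ys₂
Before-after-∷ {a} {b} {c} xs {ys₁} {ys₂} =
  subst (λ π → Unique π → Before b c π → c ∈ ys₂)
        (++-assoc xs (a ∷ ys₁) (b ∷ ys₂)) (Before-after (xs ++ a ∷ ys₁))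

Before-chain : Unique π → Before a b π → Before b c π →
               ∃[ xs ] ∃[ ys ] ∃[ zs ] ∃[ ws ] π ≡ xs ++ a ∷ ys ++ b ∷ zs ++ c ∷ ws
Before-chain u (xs , ys , refl , b∈ys) b⋯c with ys₁ , ys₂ , refl ← ∈-∃++ b∈ys
  with zs , ws , refl ← ∈-∃++ (Before-after-∷ xs u b⋯c) = xs , ys₁ , zs , ws , refl

Before-asym : Unique π → Before x y π → ¬ Before y x π
Before-asym u x⋯y y⋯x with xs , ys , zs , ws , refl ← Before-chain u x⋯y y⋯x =
  Unique-head (Unique-drop xs u) (∈-++⁺ʳ ys (there (∈-++⁺ʳ zs (here refl))))

Contains123⇒Before : Contains123 π →
  ∃[ a ] ∃[ b ] ∃[ c ] (a < b × b < c × Before a b π × Before b c π × Before a c π)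
Contains123⇒Before (a , b , c , xs , ys , zs , ws , a<b , b<c , refl) =
  a , b , c , a<b , b<c ,
  (xs , ys ++ b ∷ zs ++ c ∷ ws , refl , ∈-++⁺ʳ ys (here refl)) ,
  (xs ++ a ∷ ys , zs ++ c ∷ ws , sym (++-assoc xs (a ∷ ys) (b ∷ zs ++ c ∷ ws)) ,
   ∈-++⁺ʳ zs (here refl)) ,
  (xs , ys ++ b ∷ zs ++ c ∷ ws , refl , ∈-++⁺ʳ ys (there (∈-++⁺ʳ zs (here refl))))

-- Linear extensions of a relation on a finite set

Enumerates : (ℕ → Set) → List ℕ → Set
Enumerates P π = Unique π × (∀ {x} → x ∈ π ⇔ P x)

Extends : (ℕ → ℕ → Set) → List ℕ → Set
Extends _≺_ π = ∀ {x y} → x ≺ y → x ∈ π → y ∈ π → Before x y π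

LinExt : (ℕ → Set) → (ℕ → ℕ → Set) → List ℕ → Set
LinExt P R π = Enumerates P π × Extends R π

record Insert (z : ℕ) (P Q : ℕ → Set) : Set where
  field
    split : ∀ {x} → Q x ⇔ (x ≡ z ⊎ P x)
    fresh : ¬ P z

Enumerates-≐ : (∀ {x} → P x ⇔ Q x) → Enumerates P π → Enumerates Q π
Enumerates-≐ P⇔Q (u , mem) = u , mk⇔ (λ x∈π → to P⇔Q (to mem x∈π)) (λ q → from mem (from P⇔Q q))

Enumerates-∷⁺ : Insert z P Q → Enumerates P π → Enumerates Q (z ∷ π)
Enumerates-∷⁺ {z} {P} ins (u , mem) =
  All.tabulate (λ x∈π z≡x → fresh (subst P (sym z≡x) (to mem x∈π))) ∷ u ,
  mk⇔ (λ { (here refl) → from split (inj₁ refl) ; (there x∈π) → from split (inj₂ (to mem x∈π)) })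
      (λ q → fromSplit (to split q))
  where
  open Insert ins
  fromSplit : ∀ {x} → x ≡ z ⊎ P x → x ∈ z ∷ _
  fromSplit (inj₁ refl) = here refl
  fromSplit (inj₂ p) = there (from mem p)

Enumerates-∷⁻ : Insert z P Q → Enumerates Q (z ∷ π) → Enumerates P π
Enumerates-∷⁻ {z} {P} ins (u@(_ ∷ u′) , mem) =
  u′ , mk⇔ member (λ p → notHead p (from mem (from split (inj₂ p))))
  where
  open Insert ins
  member : ∀ {x} → x ∈ _ → P x
  member x∈π with to split (to mem (there x∈π))
  ... | inj₁ refl = ⊥-elim (Unique-head u x∈π)
  ... | inj₂ p = p
  notHead : ∀ {x} → P x → x ∈ z ∷ _ → x ∈ _
  notHead p (here refl) = ⊥-elim (fresh p)
  notHead _ (there x∈π) = x∈π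

Extends-∷⁺ : ¬ R z z → (∀ {x} → x ∈ π → ¬ R x z) → Extends R π → Extends R (z ∷ π)
Extends-∷⁺ ¬zRz _ _ zRy (here refl) (here refl) = ⊥-elim (¬zRz zRy)
Extends-∷⁺ _ _ _ _ (here refl) (there y∈π) = [] , _ , refl , y∈π
Extends-∷⁺ _ minimal _ xRz (there x∈π) (here refl) = ⊥-elim (minimal x∈π xRz)
Extends-∷⁺ _ _ ord xRy (there x∈π) (there y∈π) = Before-∷⁺ (ord xRy x∈π y∈π)

Extends-∷⁻ : Unique (z ∷ π) → Extends R (z ∷ π) → Extends R π
Extends-∷⁻ u ord xRy x∈π y∈π with Before-∷⁻ (ord xRy (there x∈π) (there y∈π))
... | inj₁ (refl , _) = ⊥-elim (Unique-head u x∈π)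
... | inj₂ x⋯y = x⋯y

Extends-head : Unique (z ∷ π) → Extends R (z ∷ π) → x ∈ π → ¬ R x z
Extends-head u ord x∈π xRz with Before-∷⁻ (ord xRz (there x∈π) (here refl))
... | inj₁ (_ , z∈π) = Unique-head u z∈π
... | inj₂ x⋯z = Unique-head u (Before⇒∈ʳ x⋯z)

Extends-mono : (∀ {x y} → x ∈ π → y ∈ π → R x y → R′ x y) → Extends R′ π → Extends R π
Extends-mono R⇒R′ ord xRy x∈π y∈π = ord (R⇒R′ x∈π y∈π xRy) x∈π y∈π

record Cell (s t x : ℕ) : Set where
  constructor cell
  field
    j0 r : ℕ
    j0<s : j0 < s
    1≤r : 1 ≤ r
    r≤t : r ≤ t
    x≡ : x ≡ j0 * t + r

ENle-intro : ∀ {j0 j0′ r r′} → j0 < s → j0′ ≤ j0 → 1 ≤ r → r ≤ r′ → r′ ≤ t →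
             ENle s t (j0 * t + r) (j0′ * t + r′)
ENle-intro j0<s j0′≤j0 1≤r r≤r′ r′≤t =
  _ , _ , _ , _ , j0<s , 1≤r , ≤-trans r≤r′ r′≤t , refl ,
  ≤-<-trans j0′≤j0 j0<s , ≤-trans 1≤r r≤r′ , r′≤t , refl , j0′≤j0 , r≤r′

ENle⇒Cellˡ : ENle s t x y → Cell s t x
ENle⇒Cellˡ (j0 , r , _ , _ , j0<s , 1≤r , r≤t , x≡ , _) = cell j0 r j0<s 1≤r r≤t x≡

ENle⇒Cellʳ : ENle s t x y → Cell s t y
ENle⇒Cellʳ (_ , _ , j0 , r , _ , _ , _ , _ , j0<s , 1≤r , r≤t , y≡ , _) = cell j0 r j0<s 1≤r r≤t y≡

∈-range⇔Cell : .{{NonZero t}} → x ∈ range (s * t) ⇔ Cell s t x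
∈-range⇔Cell {t} {x} {s} = mk⇔ toCell fromCell
  where
  toCell : x ∈ range (s * t) → Cell s t x
  toCell x∈ with k , k∈ , refl ← ∈-map⁻ suc x∈ =
    cell (k / t) (suc (k % t)) (m<n*o⇒m/o<n (∈-upTo⁻ k∈)) (s≤s z≤n) (m%n<n k t) (begin
      suc k                   ≡⟨ cong suc (m≡m%n+[m/n]*n k t) ⟩
      suc (k % t + k / t * t) ≡⟨ cong suc (+-comm (k % t) _) ⟩
      suc (k / t * t + k % t) ≡⟨ +-suc (k / t * t) (k % t) ⟨
      k / t * t + suc (k % t) ∎)
    where open ≡-Reasoning
  fromCell : Cell s t x → x ∈ range (s * t)
  fromCell (cell j0 (suc r) j0<s _ r<t refl) =
    subst (_∈ range (s * t)) (sym (+-suc (j0 * t) r)) (∈-map⁺ suc (∈-upTo⁺ (begin-strict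
      j0 * t + r  <⟨ +-monoʳ-< (j0 * t) r<t ⟩
      j0 * t + t  ≡⟨ +-comm (j0 * t) t ⟩
      suc j0 * t  ≤⟨ *-monoˡ-≤ t j0<s ⟩
      s * t       ∎)))
    where open ≤-Reasoning

↭-range⇔Enumerates : ∀ {n} → (π ↭ range n) ⇔ Enumerates (_∈ range n) π
↭-range⇔Enumerates {π} {n} = mk⇔
  (λ π↭ → Permutationₛ.Unique-resp-↭ (setoid ℕ) (↭⇒↭ₛ (↭-sym π↭)) range-unique ,
          λ {x} → mk⇔ (∈-resp-↭ π↭) (∈-resp-↭ (↭-sym π↭)))
  (λ (u , mem) → ∼bag⇒↭ (unique∧set⇒bag u range-unique λ {x} → mem {x}))
  where
  range-unique : Unique (range n)
  range-unique = map⁺ suc-injective (upTo⁺ n)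

ENlt : ℕ → ℕ → ℕ → ℕ → Set
ENlt s t x y = ENle s t x y × x ≢ y

IsLinExt⇔ : .{{NonZero t}} → IsLinExt s t π ⇔ LinExt (Cell s t) (ENlt s t) π
IsLinExt⇔ = mk⇔
  (λ (π↭ , ord) → Enumerates-≐ ∈-range⇔Cell (to ↭-range⇔Enumerates π↭) ,
                  λ (x⪯y , x≢y) _ _ → ord _ _ x⪯y x≢y)
  (λ (enum@(_ , mem) , ord) → from ↭-range⇔Enumerates (Enumerates-≐ (⇔-sym ∈-range⇔Cell) enum) ,
     λ x y x⪯y x≢y → ord (x⪯y , x≢y) (from mem (ENle⇒Cellˡ x⪯y)) (from mem (ENle⇒Cellʳ x⪯y)))

IsLinExt⇔LinExt : .{{NonZero t}} → (∀ {x} → Cell s t x ⇔ P x) →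
  (∀ {x y} → P x → P y → ENlt s t x y ⇔ R x y) → IsLinExt s t π ⇔ LinExt P R π
IsLinExt⇔LinExt {P = P} {R = R} {π = π} Cell⇔P ENlt⇔R =
  mk⇔ (λ ext → forth (to IsLinExt⇔ ext)) (λ ext → from IsLinExt⇔ (back ext))
  where
  inP : Enumerates P π → ∀ {x} → x ∈ π → P x
  inP (_ , mem) = to mem
  forth : LinExt (Cell _ _) (ENlt _ _) π → LinExt P R π
  forth (enum , ord) =
    enumP , Extends-mono (λ x∈π y∈π → from (ENlt⇔R (inP enumP x∈π) (inP enumP y∈π))) ord
    where enumP = Enumerates-≐ Cell⇔P enum
  back : LinExt P R π → LinExt (Cell _ _) (ENlt _ _) π
  back (enumP , ordR) =
    Enumerates-≐ (⇔-sym Cell⇔P) enumP ,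
    Extends-mono (λ x∈π y∈π → to (ENlt⇔R (inP enumP x∈π) (inP enumP y∈π))) ordR

linExt-unique : IsLinExt s t π → Unique π
linExt-unique (π↭ , _) = proj₁ (to ↭-range⇔Enumerates π↭)

-- Avoidance of 123 for t ≤ 2

sameColumn⇒ENle : (cx : Cell s t x) (cy : Cell s t y) → Cell.r cx ≡ Cell.r cy → x < y → ENle s t y x
sameColumn⇒ENle {t = t} (cell j0 r j0<s 1≤r r≤t refl) (cell j0′ _ j0′<s _ _ refl) refl x<y =
  ENle-intro j0′<s (<⇒≤ (*-cancelʳ-< t j0 j0′ (+-cancelʳ-< r (j0 * t) (j0′ * t) x<y))) 1≤r ≤-refl r≤t

linExt-column-decreasing : IsLinExt s t π → (cx : Cell s t x) (cy : Cell s t y) →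
                           Cell.r cx ≡ Cell.r cy → Before x y π → y < x
linExt-column-decreasing {x = x} {y = y} ext@(_ , ord) cx cy same x⋯y with <-cmp x y
... | tri< x<y _ _ =
  ⊥-elim (Before-asym (linExt-unique ext) x⋯y (ord y x (sameColumn⇒ENle cx cy same x<y) (>⇒≢ x<y)))
... | tri≈ _ refl _ = ⊥-elim (Before-asym (linExt-unique ext) x⋯y x⋯y)
... | tri> _ _ y<x = y<x

column≤2 : t ≤ 2 → (c : Cell s t x) → Cell.r c ≡ 1 ⊎ Cell.r c ≡ 2
column≤2 _ (cell _ 1 _ _ _ _) = inj₁ refl
column≤2 _ (cell _ 2 _ _ _ _) = inj₂ refl
column≤2 t≤2 (cell _ (suc (suc (suc _))) _ _ r≤t _) with s≤s (s≤s ()) ← ≤-trans r≤t t≤2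

pigeonhole : ∀ {p q r : ℕ} → p ≡ 1 ⊎ p ≡ 2 → q ≡ 1 ⊎ q ≡ 2 → r ≡ 1 ⊎ r ≡ 2 →
             p ≡ q ⊎ q ≡ r ⊎ p ≡ r
pigeonhole (inj₁ refl) (inj₁ refl) _           = inj₁ refl
pigeonhole (inj₂ refl) (inj₂ refl) _           = inj₁ refl
pigeonhole (inj₁ refl) (inj₂ refl) (inj₁ refl) = inj₂ (inj₂ refl)
pigeonhole (inj₁ refl) (inj₂ refl) (inj₂ refl) = inj₂ (inj₁ refl)
pigeonhole (inj₂ refl) (inj₁ refl) (inj₁ refl) = inj₂ (inj₁ refl)
pigeonhole (inj₂ refl) (inj₁ refl) (inj₂ refl) = inj₂ (inj₂ refl)

linExt-avoids123 : .{{NonZero t}} → t ≤ 2 → IsLinExt s t π → Avoids123 π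
linExt-avoids123 {t} {s} {π} t≤2 ext c123 =
  let (a , b , c , a<b , b<c , a⋯b , b⋯c , a⋯c) = Contains123⇒Before c123
      ca = cellOf (Before⇒∈ˡ a⋯b)
      cb = cellOf (Before⇒∈ˡ b⋯c)
      cc = cellOf (Before⇒∈ʳ b⋯c)
  in case pigeonhole (column≤2 t≤2 ca) (column≤2 t≤2 cb) (column≤2 t≤2 cc) of λ where
       (inj₁ ab)        → <-asym a<b (linExt-column-decreasing ext ca cb ab a⋯b)
       (inj₂ (inj₁ bc)) → <-asym b<c (linExt-column-decreasing ext cb cc bc b⋯c)
       (inj₂ (inj₂ ac)) → <-asym (<-trans a<b b<c) (linExt-column-decreasing ext ca cc ac a⋯c)
  where
  cellOf : ∀ {x} → x ∈ π → Cell s t x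
  cellOf = to (proj₂ (proj₁ (to IsLinExt⇔ ext)))

EN123⇔IsLinExt : .{{NonZero t}} → t ≤ 2 → EN123 s t π ⇔ IsLinExt s t π
EN123⇔IsLinExt t≤2 = mk⇔ proj₁ (λ ext → ext , linExt-avoids123 t≤2 ext)

linExt-contains123 : 1 ≤ s → 3 ≤ t → IsLinExt s t π → Contains123 π
linExt-contains123 1≤s 3≤t ext@(_ , ord)
  with xs , ys , zs , ws , refl ← Before-chain (linExt-unique ext)
         (ord 1 2 (ENle-intro 1≤s z≤n ≤-refl (n≤1+n 1) (≤-trans (n≤1+n 2) 3≤t)) (λ ()))
         (ord 2 3 (ENle-intro 1≤s z≤n (n≤1+n 1) (n≤1+n 2) 3≤t) (λ ()))
  = 1 , 2 , 3 , xs , ys , zs , ws , ≤-refl , ≤-refl , refl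

-- t = 1

Below : ℕ → ℕ → Set
Below n x = 1 ≤ x × x ≤ n

countdown : ℕ → List ℕ
countdown zero = []
countdown (suc n) = suc n ∷ countdown n

Insert-Below : ∀ {n} → Insert (suc n) (Below n) (Below (suc n))
Insert-Below {n} = record
  { split = mk⇔ split λ { (inj₁ refl) → s≤s z≤n , ≤-refl
                        ; (inj₂ (1≤x , x≤n)) → 1≤x , m≤n⇒m≤1+n x≤n }
  ; fresh = λ (_ , 1+n≤n) → 1+n≰n 1+n≤n
  }
  where
  split : Below (suc n) x → x ≡ suc n ⊎ Below n x
  split (1≤x , x≤1+n) with m≤n⇒m<n∨m≡n x≤1+n
  ... | inj₁ x<1+n = inj₂ (1≤x , ≤-pred x<1+n)
  ... | inj₂ x≡1+n = inj₁ x≡1+n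

countdown-linExt : ∀ n → LinExt (Below n) _>_ (countdown n)
countdown-linExt zero = ([] , mk⇔ (λ ()) (λ { (s≤s _ , ()) })) , λ _ ()
countdown-linExt (suc n) with enum@(_ , mem) , ord ← countdown-linExt n =
  Enumerates-∷⁺ Insert-Below enum ,
  Extends-∷⁺ (<-irrefl refl) (λ x∈ 1+n<x → <⇒≱ 1+n<x (m≤n⇒m≤1+n (proj₂ (to mem x∈)))) ord

linExt⇒countdown : ∀ n → LinExt (Below n) _>_ π → π ≡ countdown n
linExt⇒countdown {[]} zero _ = refl
linExt⇒countdown {[]} (suc n) ((_ , mem) , _) = case from mem (s≤s z≤n , ≤-refl) of λ ()
linExt⇒countdown {z ∷ π} zero ((_ , mem) , _) with s≤s _ , () ← to mem (here refl)
linExt⇒countdown {z ∷ π} (suc n) (enum@(u , mem) , ord)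
  with to (Insert.split Insert-Below) (to mem (here refl))
... | inj₁ refl =
  cong (suc n ∷_) (linExt⇒countdown n (Enumerates-∷⁻ Insert-Below enum , Extends-∷⁻ u ord))
... | inj₂ (_ , z≤n′) = ⊥-elim (Extends-head u ord top∈π (s≤s z≤n′))
  where
  top∈π : suc n ∈ π
  top∈π = tail (λ { refl → 1+n≰n z≤n′ }) (from mem (s≤s z≤n , ≤-refl))

LinExt-Below⇔countdown : ∀ n → LinExt (Below n) _>_ π ⇔ π ≡ countdown n
LinExt-Below⇔countdown n = mk⇔ (linExt⇒countdown n) (λ { refl → countdown-linExt n })

j*1+1≡1+j : ∀ j → j * 1 + 1 ≡ suc j
j*1+1≡1+j j = trans (cong (_+ 1) (*-identityʳ j)) (+-comm j 1)

Cell₁⇔Below : Cell s 1 x ⇔ Below s x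
Cell₁⇔Below {s} = mk⇔
  (λ { (cell j0 (suc zero) j0<s _ _ refl) → subst (Below s) (sym (j*1+1≡1+j j0)) (s≤s z≤n , j0<s)
     ; (cell _ (2+ _) _ _ (s≤s ()) _) })
  (λ { (s≤s {n = k} z≤n , 1+k≤s) → cell k 1 1+k≤s ≤-refl ≤-refl (sym (j*1+1≡1+j k)) })

column₁ : (c : Cell s 1 x) → Cell.r c ≡ 1
column₁ (cell _ (suc zero) _ _ _ _) = refl
column₁ (cell _ (2+ _) _ _ (s≤s ()) _)

ENle₁⇒≥ : ENle s 1 x y → y ≤ x
ENle₁⇒≥ (_ , suc zero , _ , suc zero , _ , _ , s≤s z≤n , refl , _ , _ , s≤s z≤n , refl , j0′≤j0 , _) =
  +-monoˡ-≤ 1 (*-monoˡ-≤ 1 j0′≤j0)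

ENlt₁⇔> : Below s x → Below s y → ENlt s 1 x y ⇔ x > y
ENlt₁⇔> bx by = mk⇔
  (λ (x⪯y , x≢y) → ≤∧≢⇒< (ENle₁⇒≥ x⪯y) (≢-sym x≢y))
  (λ y<x → sameColumn⇒ENle cy cx (trans (column₁ cy) (sym (column₁ cx))) y<x , >⇒≢ y<x)
  where
  cx = from Cell₁⇔Below bx
  cy = from Cell₁⇔Below by

EN123₁⇔countdown : EN123 s 1 π ⇔ π ≡ countdown s
EN123₁⇔countdown {s} = LinExt-Below⇔countdown s ⇔-∘
  (IsLinExt⇔LinExt Cell₁⇔Below ENlt₁⇔> ⇔-∘ EN123⇔IsLinExt (s≤s z≤n))

-- t = 2

-- od i and ev i are the elements j0 * 2 + 1 and j0 * 2 + 2 of row j0 = i of EN_{s,2}.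
od ev : ℕ → ℕ
od i = i * 2 + 1
ev i = i * 2 + 2

od-injective : od i ≡ od k → i ≡ k
od-injective {i} {k} eq = *-cancelʳ-≡ i k 2 (+-cancelʳ-≡ 1 (i * 2) (k * 2) eq)

ev-injective : ev i ≡ ev k → i ≡ k
ev-injective {i} {k} eq = *-cancelʳ-≡ i k 2 (+-cancelʳ-≡ 2 (i * 2) (k * 2) eq)

od≢ev : ∀ i k → od i ≢ ev k
od≢ev zero    zero    ()
od≢ev zero    (suc k) ()
od≢ev (suc i) zero    eq with () ← trans (sym (+-comm (i * 2) 1)) (suc-injective (suc-injective eq))
od≢ev (suc i) (suc k) eq = od≢ev i k (suc-injective (suc-injective eq))

data InShape (a b x : ℕ) : Set where
  odd  : i < a → x ≡ od i → InShape a b x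
  even : i < b → x ≡ ev i → InShape a b x

data _≺₂_ (x y : ℕ) : Set where
  od≺od : k < i → x ≡ od i → y ≡ od k → x ≺₂ y
  ev≺ev : k < i → x ≡ ev i → y ≡ ev k → x ≺₂ y
  od≺ev : k ≤ i → x ≡ od i → y ≡ ev k → x ≺₂ y

LinExt₂ : ℕ → ℕ → List ℕ → Set
LinExt₂ a b = LinExt (InShape a b) _≺₂_

od∈InShape⇒ : InShape a b (od i) → i < a
od∈InShape⇒ {i = i} (odd {j} j<a eq) = subst (_< _) (od-injective {j} {i} (sym eq)) j<a
od∈InShape⇒ {i = i} (even {j} _ eq) = ⊥-elim (od≢ev i j eq)

ev∈InShape⇒ : InShape a b (ev i) → i < b
ev∈InShape⇒ {i = i} (odd {j} _ eq) = ⊥-elim (od≢ev j i (sym eq))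
ev∈InShape⇒ {i = i} (even {j} j<b eq) = subst (_< _) (ev-injective {j} {i} (sym eq)) j<b

Insert-od : Insert (od a) (InShape a b) (InShape (suc a) b)
Insert-od {a} {b} = record
  { split = mk⇔ split λ { (inj₁ refl) → odd ≤-refl refl
                        ; (inj₂ (odd i<a eq)) → odd (m<n⇒m<1+n i<a) eq
                        ; (inj₂ (even i<b eq)) → even i<b eq }
  ; fresh = λ top → <-irrefl refl (od∈InShape⇒ top)
  }
  where
  split : InShape (suc a) b x → x ≡ od a ⊎ InShape a b x
  split (even i<b eq) = inj₂ (even i<b eq)
  split (odd i<1+a eq) with m<1+n⇒m<n∨m≡n i<1+a
  ... | inj₁ i<a = inj₂ (odd i<a eq)
  ... | inj₂ refl = inj₁ eq

Insert-ev : Insert (ev b) (InShape a b) (InShape a (suc b))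
Insert-ev {b} {a} = record
  { split = mk⇔ split λ { (inj₁ refl) → even ≤-refl refl
                        ; (inj₂ (odd i<a eq)) → odd i<a eq
                        ; (inj₂ (even i<b eq)) → even (m<n⇒m<1+n i<b) eq }
  ; fresh = λ top → <-irrefl refl (ev∈InShape⇒ top)
  }
  where
  split : InShape a (suc b) x → x ≡ ev b ⊎ InShape a b x
  split (odd i<a eq) = inj₂ (odd i<a eq)
  split (even i<1+b eq) with m<1+n⇒m<n∨m≡n i<1+b
  ... | inj₁ i<b = inj₂ (even i<b eq)
  ... | inj₂ refl = inj₁ eq

≺₂-irrefl : ¬ x ≺₂ x
≺₂-irrefl (od≺od {k} {i} k<i refl eq) = <-irrefl (od-injective {k} {i} (sym eq)) k<i
≺₂-irrefl (ev≺ev {k} {i} k<i refl eq) = <-irrefl (ev-injective {k} {i} (sym eq)) k<i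
≺₂-irrefl (od≺ev {k} {i} _ refl eq) = od≢ev i k eq

Cell₂⇔InShape : Cell s 2 x ⇔ InShape s s x
Cell₂⇔InShape = mk⇔
  (λ { (cell j0 1 j0<s _ _ eq) → odd j0<s eq
     ; (cell j0 2 j0<s _ _ eq) → even j0<s eq
     ; (cell _ (suc (suc (suc _))) _ _ (s≤s (s≤s ())) _) })
  (λ { (odd i<s eq) → cell _ 1 i<s ≤-refl (s≤s z≤n) eq
     ; (even i<s eq) → cell _ 2 i<s (s≤s z≤n) ≤-refl eq })

ENle₂⇒≺₂ : ENle s 2 x y → x ≢ y → x ≺₂ y
ENle₂⇒≺₂ (j0 , 1 , j0′ , 1 , _ , _ , _ , refl , _ , _ , _ , refl , j0′≤j0 , _) x≢y
  with m≤n⇒m<n∨m≡n j0′≤j0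
... | inj₁ j0′<j0 = od≺od j0′<j0 refl refl
... | inj₂ refl = ⊥-elim (x≢y refl)
ENle₂⇒≺₂ (j0 , 2 , j0′ , 2 , _ , _ , _ , refl , _ , _ , _ , refl , j0′≤j0 , _) x≢y
  with m≤n⇒m<n∨m≡n j0′≤j0
... | inj₁ j0′<j0 = ev≺ev j0′<j0 refl refl
... | inj₂ refl = ⊥-elim (x≢y refl)
ENle₂⇒≺₂ (j0 , 1 , j0′ , 2 , _ , _ , _ , refl , _ , _ , _ , refl , j0′≤j0 , _) _ = od≺ev j0′≤j0 refl refl
ENle₂⇒≺₂ (_ , 2 , _ , 1 , _ , _ , _ , _ , _ , _ , _ , _ , _ , s≤s ()) _
ENle₂⇒≺₂ (_ , suc (suc (suc _)) , _ , _ , _ , _ , s≤s (s≤s ()) , _) _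
ENle₂⇒≺₂ (_ , _ , _ , suc (suc (suc _)) , _ , _ , _ , _ , _ , _ , s≤s (s≤s ()) , _) _

≺₂⇒ENle : InShape s s x → x ≺₂ y → ENle s 2 x y
≺₂⇒ENle x∈ (od≺od k<i refl refl) = ENle-intro (od∈InShape⇒ x∈) (<⇒≤ k<i) ≤-refl ≤-refl (s≤s z≤n)
≺₂⇒ENle x∈ (ev≺ev k<i refl refl) = ENle-intro (ev∈InShape⇒ x∈) (<⇒≤ k<i) (s≤s z≤n) ≤-refl ≤-refl
≺₂⇒ENle x∈ (od≺ev k≤i refl refl) = ENle-intro (od∈InShape⇒ x∈) k≤i ≤-refl (s≤s z≤n) ≤-refl

ENlt₂⇔≺₂ : InShape s s x → InShape s s y → ENlt s 2 x y ⇔ x ≺₂ y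
ENlt₂⇔≺₂ x∈ _ = mk⇔ (λ (x⪯y , x≢y) → ENle₂⇒≺₂ x⪯y x≢y)
                    (λ x≺y → ≺₂⇒ENle x∈ x≺y , λ { refl → ≺₂-irrefl x≺y })

od-minimal : InShape a b x → ¬ x ≺₂ od a
od-minimal {a} x∈ (od≺od {k} k<i refl eq) with refl ← od-injective {a} {k} eq =
  <-asym k<i (od∈InShape⇒ x∈)
od-minimal {a} _ (ev≺ev {k} _ _ eq) = od≢ev a k eq
od-minimal {a} _ (od≺ev {k} _ _ eq) = od≢ev a k eq

ev-minimal : a ≤ b → InShape a b x → ¬ x ≺₂ ev b
ev-minimal {b = b} _ _ (od≺od {k} _ _ eq) = od≢ev k b (sym eq)
ev-minimal {b = b} _ x∈ (ev≺ev {k} k<i refl eq) with refl ← ev-injective {b} {k} eq =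
  <-asym k<i (ev∈InShape⇒ x∈)
ev-minimal {b = b} a≤b x∈ (od≺ev {k} k≤i refl eq) with refl ← ev-injective {b} {k} eq =
  <⇒≱ (<-≤-trans (od∈InShape⇒ x∈) a≤b) k≤i

linExt-∷od : LinExt₂ a b π → LinExt₂ (suc a) b (od a ∷ π)
linExt-∷od (enum@(_ , mem) , ord) =
  Enumerates-∷⁺ Insert-od enum , Extends-∷⁺ ≺₂-irrefl (λ x∈π → od-minimal (to mem x∈π)) ord

linExt-∷ev : a ≤ b → LinExt₂ a b π → LinExt₂ a (suc b) (ev b ∷ π)
linExt-∷ev a≤b (enum@(_ , mem) , ord) =
  Enumerates-∷⁺ Insert-ev enum , Extends-∷⁺ ≺₂-irrefl (λ x∈π → ev-minimal a≤b (to mem x∈π)) ord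

linExt-head-od : LinExt₂ (suc a) b (od i ∷ π) → i < suc a → i ≡ a
linExt-head-od {a} {i = i} ((u , mem) , ord) i<1+a with m<1+n⇒m<n∨m≡n i<1+a
... | inj₂ i≡a = i≡a
... | inj₁ i<a = ⊥-elim (Extends-head u ord top∈π (od≺od i<a refl refl))
  where
  top∈π = tail (λ eq → <-irrefl (od-injective (sym eq)) i<a) (from mem (odd ≤-refl refl))

linExt-head-ev : LinExt₂ a (suc b) (ev i ∷ π) → i < suc b → i ≡ b × a ≤ b
linExt-head-ev {a} {b} {i} ((u , mem) , ord) i<1+b with m<1+n⇒m<n∨m≡n i<1+b
... | inj₁ i<b = ⊥-elim (Extends-head u ord top∈π (ev≺ev i<b refl refl))
  where
  top∈π = tail (λ eq → <-irrefl (ev-injective (sym eq)) i<b) (from mem (even ≤-refl refl))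
... | inj₂ refl with a ≤? b
...   | yes a≤b = refl , a≤b
...   | no a≰b with suc a′ ← a | s≤s b≤a′ ← ≰⇒> a≰b =
  ⊥-elim (Extends-head u ord od∈π (od≺ev b≤a′ refl refl))
  where
  od∈π = tail (λ eq → od≢ev a′ b eq) (from mem (odd ≤-refl refl))

-- The lists π with LinExt₂ a b π, grouped by their first element: the largest odd element can
-- always come first, the largest even element ev b′ (b = suc b′) only if no od i with i ≥ b′
-- remains, that is, if a ≤ b′.
linExts₂ : ℕ → ℕ → List (List ℕ)
linExts₂ zero    zero    = [ [] ]
linExts₂ zero    (suc b) = map (ev b ∷_) (linExts₂ zero b)
linExts₂ (suc a) zero    = map (od a ∷_) (linExts₂ a zero)
linExts₂ (suc a) (suc b) with suc a ≤? b
... | yes _ = map (od a ∷_) (linExts₂ a (suc b)) ++ map (ev b ∷_) (linExts₂ (suc a) b)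
... | no  _ = map (od a ∷_) (linExts₂ a (suc b))

linExts₂-∷od : π ∈ linExts₂ a b → od a ∷ π ∈ linExts₂ (suc a) b
linExts₂-∷od {b = zero} π∈L = ∈-map⁺ _ π∈L
linExts₂-∷od {a = a} {b = suc b} π∈L with suc a ≤? b
... | yes _ = ∈-++⁺ˡ (∈-map⁺ _ π∈L)
... | no  _ = ∈-map⁺ _ π∈L

linExts₂-∷ev : a ≤ b → π ∈ linExts₂ a b → ev b ∷ π ∈ linExts₂ a (suc b)
linExts₂-∷ev {zero} _ π∈L = ∈-map⁺ _ π∈L
linExts₂-∷ev {suc a} {b} a≤b π∈L with suc a ≤? b
... | yes _ = ∈-++⁺ʳ _ (∈-map⁺ _ π∈L)
... | no a≰b = ⊥-elim (a≰b a≤b)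

linExts₂-sound : ∀ a b → π ∈ linExts₂ a b → LinExt₂ a b π
linExts₂-sound zero zero (here refl) = ([] , mk⇔ (λ ()) (λ { (odd () _) ; (even () _) })) , λ _ ()
linExts₂-sound zero (suc b) π∈L with π′ , π′∈L , refl ← map∷⁻ π∈L =
  linExt-∷ev z≤n (linExts₂-sound zero b π′∈L)
linExts₂-sound (suc a) zero π∈L with π′ , π′∈L , refl ← map∷⁻ π∈L =
  linExt-∷od (linExts₂-sound a zero π′∈L)
linExts₂-sound (suc a) (suc b) π∈L with suc a ≤? b
... | no _ with π′ , π′∈L , refl ← map∷⁻ π∈L = linExt-∷od (linExts₂-sound a (suc b) π′∈L)
... | yes a<b with ∈-++⁻ (map (od a ∷_) (linExts₂ a (suc b))) π∈L
...   | inj₁ π∈L₁ with π′ , π′∈L , refl ← map∷⁻ π∈L₁ =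
  linExt-∷od (linExts₂-sound a (suc b) π′∈L)
...   | inj₂ π∈L₂ with π′ , π′∈L , refl ← map∷⁻ π∈L₂ =
  linExt-∷ev a<b (linExts₂-sound (suc a) b π′∈L)

linExts₂-complete : LinExt₂ a b π → π ∈ linExts₂ a b
linExts₂-complete {zero}  {zero}  {[]} _ = here refl
linExts₂-complete {suc a} {_}     {[]} ((_ , mem) , _) = case from mem (odd {i = a} ≤-refl refl) of λ ()
linExts₂-complete {zero}  {suc b} {[]} ((_ , mem) , _) = case from mem (even {i = b} ≤-refl refl) of λ ()
linExts₂-complete {a} {b} {z ∷ π} ext@(enum@(u , mem) , ord) with to mem (here refl)
... | odd i<a@(s≤s _) refl with refl ← linExt-head-od ext i<a =
  linExts₂-∷od {b = b} (linExts₂-complete (Enumerates-∷⁻ Insert-od enum , Extends-∷⁻ u ord))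
... | even i<b@(s≤s _) refl with refl , a≤b ← linExt-head-ev ext i<b =
  linExts₂-∷ev a≤b (linExts₂-complete (Enumerates-∷⁻ Insert-ev enum , Extends-∷⁻ u ord))

∈-linExts₂⇔ : π ∈ linExts₂ a b ⇔ LinExt₂ a b π
∈-linExts₂⇔ {a = a} {b} = mk⇔ (linExts₂-sound a b) linExts₂-complete

linExts₂-unique : ∀ a b → Unique (linExts₂ a b)
linExts₂-unique zero    zero    = All.[] ∷ []
linExts₂-unique zero    (suc b) = map⁺ ∷-injectiveʳ (linExts₂-unique zero b)
linExts₂-unique (suc a) zero    = map⁺ ∷-injectiveʳ (linExts₂-unique a zero)
linExts₂-unique (suc a) (suc b) with suc a ≤? b
... | no  _ = map⁺ ∷-injectiveʳ (linExts₂-unique a (suc b))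
... | yes _ = ++⁺ (map⁺ ∷-injectiveʳ (linExts₂-unique a (suc b)))
                  (map⁺ ∷-injectiveʳ (linExts₂-unique (suc a) b)) disjoint
  where
  disjoint : ∀ {π} → ¬ (π ∈ map (od a ∷_) (linExts₂ a (suc b)) ×
                         π ∈ map (ev b ∷_) (linExts₂ (suc a) b))
  disjoint (π∈₁ , π∈₂) with _ , _ , refl ← map∷⁻ π∈₁ | _ , _ , eq ← map∷⁻ π∈₂ =
    od≢ev a b (proj₁ (∷-injective eq))

EN123₂⇔linExts₂ : EN123 s 2 π ⇔ π ∈ linExts₂ s s
EN123₂⇔linExts₂ = ⇔-sym ∈-linExts₂⇔ ⇔-∘
  (IsLinExt⇔LinExt Cell₂⇔InShape ENlt₂⇔≺₂ ⇔-∘ EN123⇔IsLinExt ≤-refl)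

-- Ballot and Catalan numbers

module _ where
  open ≡-Reasoning

  [k+1]*[n+1]C[k+1]≡[n+1]*nCk : ∀ n k → suc k * (suc n C suc k) ≡ suc n * (n C k)
  [k+1]*[n+1]C[k+1]≡[n+1]*nCk zero zero = refl
  [k+1]*[n+1]C[k+1]≡[n+1]*nCk zero (suc k) = begin
    2+ k * (1 C 2+ k) ≡⟨ cong (2+ k *_) (k>n⇒nCk≡0 {1} {2+ k} (s≤s (s≤s z≤n))) ⟩
    2+ k * 0          ≡⟨ *-zeroʳ (2+ k) ⟩
    0                 ≡⟨ cong (1 *_) (k>n⇒nCk≡0 {0} {suc k} (s≤s z≤n)) ⟨
    1 * (0 C suc k)   ∎
  [k+1]*[n+1]C[k+1]≡[n+1]*nCk (suc n) zero = begin
    1 * (2+ n C 1) ≡⟨ *-identityˡ _ ⟩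
    2+ n C 1       ≡⟨ nC1≡n (2+ n) ⟩
    2+ n           ≡⟨ *-identityʳ _ ⟨
    2+ n * 1       ∎
  [k+1]*[n+1]C[k+1]≡[n+1]*nCk (suc n) (suc k) = begin
    2+ k * (2+ n C 2+ k)                      ≡⟨ cong (2+ k *_) (nCk+nC[k+1]≡[n+1]C[k+1] (suc n) (suc k)) ⟨
    2+ k * (A + B)                            ≡⟨ *-distribˡ-+ (2+ k) A B ⟩
    (A + suc k * A) + 2+ k * B                ≡⟨ cong₂ (λ u v → (A + u) + v) (IH n k) (IH n (suc k)) ⟩
    (A + suc n * (n C k)) + suc n * (n C suc k) ≡⟨ +-assoc A _ _ ⟩
    A + (suc n * (n C k) + suc n * (n C suc k)) ≡⟨ cong (A +_) (*-distribˡ-+ (suc n) (n C k) (n C suc k)) ⟨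
    A + suc n * (n C k + n C suc k)           ≡⟨ cong (λ u → A + suc n * u) (nCk+nC[k+1]≡[n+1]C[k+1] n k) ⟩
    A + suc n * A                             ∎
    where
    A = suc n C suc k
    B = suc n C 2+ k
    IH = [k+1]*[n+1]C[k+1]≡[n+1]*nCk

  C-central-sym : ∀ a → (a + suc a) C a ≡ (a + suc a) C suc a
  C-central-sym a = begin
    (a + suc a) C a               ≡⟨ nCk≡nC[n∸k] (m≤m+n a (suc a)) ⟩
    (a + suc a) C (a + suc a ∸ a) ≡⟨ cong ((a + suc a) C_) (m+n∸m≡n a (suc a)) ⟩
    (a + suc a) C suc a           ∎

  [s+1]*[2s]C[s+1]≡s*[2s]Cs : ∀ s → suc s * ((s + s) C suc s) ≡ s * ((s + s) C s)
  [s+1]*[2s]C[s+1]≡s*[2s]Cs zero = refl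
  [s+1]*[2s]C[s+1]≡s*[2s]Cs (suc s) = begin
    2+ s * (suc n C 2+ s)   ≡⟨ [k+1]*[n+1]C[k+1]≡[n+1]*nCk n (suc s) ⟩
    suc n * (n C suc s)     ≡⟨ cong (suc n *_) (C-central-sym s) ⟨
    suc n * (n C s)         ≡⟨ [k+1]*[n+1]C[k+1]≡[n+1]*nCk n s ⟨
    suc s * (suc n C suc s) ∎
    where n = s + suc s

  catalan-ballot : ∀ s f → f + (s + s) C suc s ≡ (s + s) C s → catalan s ≡ f
  catalan-ballot s f ballot = begin
    ((2 * s) C s) / suc s ≡⟨ cong (λ m → (m C s) / suc s) (cong (s +_) (+-identityʳ s)) ⟩
    M / suc s             ≡⟨ cong (_/ suc s) M≡f*[s+1] ⟩
    f * suc s / suc s     ≡⟨ m*n/n≡m f (suc s) ⟩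
    f                     ∎
    where
    M = (s + s) C s
    M′ = (s + s) C suc s
    M≡f*[s+1] : M ≡ f * suc s
    M≡f*[s+1] = +-cancelʳ-≡ (s * M) M (f * suc s) (begin
      M + s * M              ≡⟨ *-comm (suc s) M ⟩
      M * suc s              ≡⟨ cong (_* suc s) ballot ⟨
      (f + M′) * suc s       ≡⟨ *-distribʳ-+ (suc s) f M′ ⟩
      f * suc s + M′ * suc s ≡⟨ cong (f * suc s +_) (*-comm M′ (suc s)) ⟩
      f * suc s + suc s * M′ ≡⟨ cong (f * suc s +_) ([s+1]*[2s]C[s+1]≡s*[2s]Cs s) ⟩
      f * suc s + s * M      ∎)

  length-linExts₂-zero : ∀ b → length (linExts₂ zero b) ≡ 1
  length-linExts₂-zero zero = refl
  length-linExts₂-zero (suc b) = trans (length-map _ (linExts₂ zero b)) (length-linExts₂-zero b)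

  +-interchange : ∀ p q r t → (p + q) + (r + t) ≡ (p + t) + (q + r)
  +-interchange = solve-∀

  -- The ballot number C(a+b,b) − C(a+b,b+1), stated without truncated subtraction.
  length-linExts₂ : ∀ a b → a ≤ b → length (linExts₂ a b) + (a + b) C suc b ≡ (a + b) C b
  length-linExts₂ zero zero _ = refl
  length-linExts₂ zero (suc b) _ = begin
    length (map (ev b ∷_) (linExts₂ zero b)) + suc b C 2+ b
      ≡⟨ cong₂ _+_ (trans (length-map _ (linExts₂ zero b)) (length-linExts₂-zero b))
                   (k>n⇒nCk≡0 (n<1+n (suc b))) ⟩
    1             ≡⟨ nCn≡1 (suc b) ⟨
    suc b C suc b ∎
  length-linExts₂ (suc a) (suc b) (s≤s a≤b) with suc a ≤? b
  ... | yes a<b = begin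
    length (map (od a ∷_) (linExts₂ a (suc b)) ++ map (ev b ∷_) (linExts₂ (suc a) b)) + suc n C 2+ b
      ≡⟨ cong₂ _+_ (trans (length-++ (map (od a ∷_) (linExts₂ a (suc b))))
                          (cong₂ _+_ (length-map _ (linExts₂ a (suc b))) (length-map _ (linExts₂ (suc a) b))))
                   (sym (nCk+nC[k+1]≡[n+1]C[k+1] n (suc b))) ⟩
    (ℓ₁ + ℓ₂) + (n C suc b + n C 2+ b) ≡⟨ +-interchange ℓ₁ ℓ₂ (n C suc b) (n C 2+ b) ⟩
    (ℓ₁ + n C 2+ b) + (ℓ₂ + n C suc b) ≡⟨ cong₂ _+_ ballot₁ ballot₂ ⟩
    n C suc b + n C b                  ≡⟨ +-comm (n C suc b) (n C b) ⟩
    n C b + n C suc b                  ≡⟨ nCk+nC[k+1]≡[n+1]C[k+1] n b ⟩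
    suc n C suc b                      ∎
    where
    n = a + suc b
    ℓ₁ = length (linExts₂ a (suc b))
    ℓ₂ = length (linExts₂ (suc a) b)
    ballot₁ : ℓ₁ + n C 2+ b ≡ n C suc b
    ballot₁ = length-linExts₂ a (suc b) (m≤n⇒m≤1+n a≤b)
    ballot₂ : ℓ₂ + n C suc b ≡ n C b
    ballot₂ = subst (λ m → ℓ₂ + m C suc b ≡ m C b) (sym (+-suc a b)) (length-linExts₂ (suc a) b a<b)
  ... | no a≮b with refl ← ≤-antisym a≤b (≮⇒≥ a≮b) = begin
    length (map (od a ∷_) (linExts₂ a (suc a))) + suc n C 2+ a
      ≡⟨ cong₂ _+_ (length-map _ (linExts₂ a (suc a))) (sym (nCk+nC[k+1]≡[n+1]C[k+1] n (suc a))) ⟩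
    ℓ + (n C suc a + n C 2+ a) ≡⟨ cong (ℓ +_) (+-comm (n C suc a) _) ⟩
    ℓ + (n C 2+ a + n C suc a) ≡⟨ +-assoc ℓ _ _ ⟨
    (ℓ + n C 2+ a) + n C suc a ≡⟨ cong (_+ n C suc a) (length-linExts₂ a (suc a) (n≤1+n a)) ⟩
    n C suc a + n C suc a      ≡⟨ cong (_+ n C suc a) (C-central-sym a) ⟨
    n C a + n C suc a          ≡⟨ nCk+nC[k+1]≡[n+1]C[k+1] n a ⟩
    suc n C suc a              ∎
    where
    n = a + suc a
    ℓ = length (linExts₂ a (suc a))


EN123₁-card : ∀ s → HasCard (EN123 s 1) 1
EN123₁-card s = [ countdown s ] , All.[] ∷ [] ,
  (λ π → mk⇔ (λ { (here refl) → from EN123₁⇔countdown refl }) (λ e → here (to EN123₁⇔countdown e))) ,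
  refl

EN123₂-card : ∀ s → HasCard (EN123 s 2) (catalan s)
EN123₂-card s = linExts₂ s s , linExts₂-unique s s , (λ π → ⇔-sym EN123₂⇔linExts₂) ,
  sym (catalan-ballot s (length (linExts₂ s s)) (length-linExts₂ s s ≤-refl))

EN123-empty : 1 ≤ s → 3 ≤ t → HasCard (EN123 s t) 0
EN123-empty 1≤s 3≤t = [] , [] ,
  (λ π → mk⇔ (λ ()) (λ (ext , avoids) → ⊥-elim (avoids (linExt-contains123 1≤s 3≤t ext)))) ,
  refl

theorem3p4 : (s t : ℕ) → 1 ≤ s → 3 ≤ t →
    HasCard (EN123 s 1) 1 × HasCard (EN123 s 2) (catalan s) × HasCard (EN123 s t) 0
theorem3p4 s t 1≤s 3≤t = EN123₁-card s , EN123₂-card s , EN123-empty 1≤s 3≤t
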